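{- Let $\mathcal{C} = (E, \mathcal{A}, \pi, \mathit{ok}, \vdash, \Vdash)$ be a contract. For every event $e \in E$: $e$ is reachable in $\mathcal{C}$ if and only if $[\mathcal{C}] \vdash_{\mathrm{PCL}} \pi(e) \;\mathit{says}\; e$.
   Context: A contract is a 6-tuple $\mathcal{C} = (E, \mathcal{A}, \pi, \mathit{ok}, \vdash, \Vdash)$ where $E$ is a finite set of events, $\mathcal{A}$ is a finite set of participants, $\pi : E \to \mathcal{A}$, $\mathit{ok} \subseteq \mathcal{A} \times \mathcal{P}(E)$ is upward closed in its second argument, and $\vdash, \Vdash \subseteq \mathcal{P}(E) \times E$ are saturated: $X \circ e$ and $X \subseteq Y$ imply $Y \circ e$ for $\circ \in \{\vdash, \Vdash\}$. A set $C \subseteq E$ is a configuration iff there exist $e_0, \ldots, e_n$ with $\{e_0,\ldots,e_n\} = C$ such that for every $i \le n$, either $\{e_0,\ldots,e_{i-1}\} \vdash e_i$ or $C \Vdash e_i$. An event is reachable if it belongs to some configuration. Propositional Contract Logic (PCL): formulae are built from atoms (here: the events of $E$), $\top$, the intuitionistic connectives ($\wedge, \vee, \rightarrow, \bot$), a binary connective $\twoheadrightarrow$ (contractual implication), and unary modalities $A \;\mathit{says}\; \varphi$ indexed by principals $A$ (here: participants). Provability $\Gamma \vdash_{\mathrm{PCL}} \varphi$ is given by the Hilbert system consisting of all axioms of intuitionistic propositional logic, modus ponens, and the axioms $\top \twoheadrightarrow \top$; $(\varphi \twoheadrightarrow \varphi) \rightarrow \varphi$; $(\varphi' \rightarrow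 \varphi) \rightarrow (\varphi \twoheadrightarrow \psi) \rightarrow (\psi \rightarrow \psi') \rightarrow (\varphi' \twoheadrightarrow \psi')$; $\varphi \rightarrow (A \;\mathit{says}\; \varphi)$; $(A \;\mathit{says}\; A \;\mathit{says}\; \varphi) \rightarrow A \;\mathit{says}\; \varphi$; $(\varphi \rightarrow \psi) \rightarrow (A \;\mathit{says}\; \varphi) \rightarrow (A \;\mathit{says}\; \psi)$. Translation of contracts: for $\circ \in \{\vdash, \Vdash\}$ and a pair $\{d_i : i \in I\} \circ a$, set $[\{d_i : i \in I\} \circ a] = \pi(a) \;\mathit{says}\; \big( (\bigwedge_{i \in I} \pi(d_i) \;\mathit{says}\; d_i) \,[\circ]\, a \big)$, where $[\vdash] = \rightarrow$, $[\Vdash] = \twoheadrightarrow$, and the empty conjunction is $\top$. Then $[\mathcal{C}]$ is the conjunction of $[D \circ a]$ over all pairs $(D,a)$ in $\vdash$ and in $\Vdash$. -}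

module Defs where

open import Data.Nat using (ℕ; zero; suc)
open import Data.Fin using (Fin)
open import Data.Fin.Subset using (Subset; _∈_; _⊆_; _∪_; ⁅_⁆) renaming (⊥ to ∅)
open import Data.Bool using (Bool; true; false)
open import Data.Vec using (Vec; []; _∷_)
open import Data.List using (List; []; _∷_; _++_; map; foldr; filter; allFin; concatMap)
import Data.List.Membership.Propositional as LM
import Data.Product
import Data.Bool
open import Data.Product using (Σ; _×_; _,_; ∃)
open import Data.Sum using (_⊎_)
open import Data.Unit using (⊤)
open import Relation.Binary.PropositionalEquality using (_≡_)
open import Relation.Nullary using (does)
open import Data.Fin.Subset.Properties using (_∈?_)
open import Function.Bundles using (_⇔_)

-- Contracts.  Events E = Fin n, participants 𝒜 = Fin m.
-- Relations on the finite sets P(E) × E and 𝒜 × P(E) are given by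
-- their (Boolean) characteristic functions.

record Contract (n m : ℕ) : Set where
  field
    π        : Fin n → Fin m
    ok       : Fin m → Subset n → Bool
    ok-up    : ∀ A X Y → X ⊆ Y → ok A X ≡ true → ok A Y ≡ true
    enables  : Subset n → Fin n → Bool      -- X ⊢ e
    enablesC : Subset n → Fin n → Bool      -- X ⊩ e
    sat-⊢    : ∀ X Y e → X ⊆ Y → enables X e ≡ true → enables Y e ≡ true
    sat-⊩    : ∀ X Y e → X ⊆ Y → enablesC X e ≡ true → enablesC Y e ≡ true

module _ {n m : ℕ} (𝒞 : Contract n m) where
  open Contract 𝒞

  -- validSeq C P es : the sequence es is admissible for configuration C,
  -- where P is the set of events preceding it:
  -- each e_i satisfies {e_0..e_{i-1}} ⊢ e_i  or  C ⊩ e_i.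
  validSeq : Subset n → Subset n → List (Fin n) → Set
  validSeq C P []       = ⊤
  validSeq C P (e ∷ es) =
    (enables P e ≡ true ⊎ enablesC C e ≡ true) × validSeq C (P ∪ ⁅ e ⁆) es

  IsConfiguration : Subset n → Set
  IsConfiguration C =
    Σ (List (Fin n)) λ es →
      (∀ x → (x ∈ C) ⇔ (x LM.∈ es)) × validSeq C ∅ es

  Reachable : Fin n → Set
  Reachable e = Σ (Subset n) λ C → IsConfiguration C × e ∈ C

infixr 6 _∧_
infixr 5 _∨_
infixr 4 _⇒_ _↠_
infixr 8 _says_

data Form (n m : ℕ) : Set where
  atom : Fin n → Form n m
  ⊤′ ⊥′ : Form n m
  _∧_ _∨_ _⇒_ _↠_ : Form n m → Form n m → Form n m
  _says_ : Fin m → Form n m → Form n m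

data _⊢PCL_ {n m : ℕ} (Γ : List (Form n m)) : Form n m → Set where
  hyp  : ∀ {φ} → φ LM.∈ Γ → Γ ⊢PCL φ
  mp   : ∀ {φ ψ} → Γ ⊢PCL (φ ⇒ ψ) → Γ ⊢PCL φ → Γ ⊢PCL ψ
  ax-K   : ∀ {φ ψ} → Γ ⊢PCL (φ ⇒ ψ ⇒ φ)
  ax-S   : ∀ {φ ψ χ} → Γ ⊢PCL ((φ ⇒ ψ ⇒ χ) ⇒ (φ ⇒ ψ) ⇒ φ ⇒ χ)
  ax-∧I  : ∀ {φ ψ} → Γ ⊢PCL (φ ⇒ ψ ⇒ φ ∧ ψ)
  ax-∧E₁ : ∀ {φ ψ} → Γ ⊢PCL (φ ∧ ψ ⇒ φ)
  ax-∧E₂ : ∀ {φ ψ} → Γ ⊢PCL (φ ∧ ψ ⇒ ψ)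
  ax-∨I₁ : ∀ {φ ψ} → Γ ⊢PCL (φ ⇒ φ ∨ ψ)
  ax-∨I₂ : ∀ {φ ψ} → Γ ⊢PCL (ψ ⇒ φ ∨ ψ)
  ax-∨E  : ∀ {φ ψ χ} → Γ ⊢PCL ((φ ⇒ χ) ⇒ (ψ ⇒ χ) ⇒ φ ∨ ψ ⇒ χ)
  ax-⊥E  : ∀ {φ} → Γ ⊢PCL (⊥′ ⇒ φ)
  ax-⊤   : Γ ⊢PCL ⊤′
  ax-↠⊤    : Γ ⊢PCL (⊤′ ↠ ⊤′)
  ax-↠fix  : ∀ {φ} → Γ ⊢PCL ((φ ↠ φ) ⇒ φ)
  ax-↠mono : ∀ {φ φ′ ψ ψ′} →
             Γ ⊢PCL ((φ′ ⇒ φ) ⇒ (φ ↠ ψ) ⇒ (ψ ⇒ ψ′) ⇒ (φ′ ↠ ψ′))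
  ax-unit : ∀ {A φ} → Γ ⊢PCL (φ ⇒ A says φ)
  ax-join : ∀ {A φ} → Γ ⊢PCL (A says A says φ ⇒ A says φ)
  ax-map  : ∀ {A φ ψ} → Γ ⊢PCL ((φ ⇒ ψ) ⇒ A says φ ⇒ A says ψ)

⋀ : ∀ {n m} → List (Form n m) → Form n m
⋀ = foldr _∧_ ⊤′

allSubsets : ∀ n → List (Subset n)
allSubsets zero    = [] ∷ []
allSubsets (suc n) = concatMap (λ s → (true ∷ s) ∷ (false ∷ s) ∷ []) (allSubsets n)

elems : ∀ {n} → Subset n → List (Fin n)
elems {n} D = filter (λ x → x ∈? D) (allFin n)

module _ {n m : ℕ} (𝒞 : Contract n m) where
  open Contract 𝒞

  -- [D ∘ a] = π(a) says ((⋀_{d ∈ D} π(d) says d) [∘] a)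
  trPair : (Form n m → Form n m → Form n m) → Subset n → Fin n → Form n m
  trPair op D a =
    π a says (op (⋀ (map (λ d → π d says atom d) (elems D))) (atom a))

  pairsOf : (Subset n → Fin n → Bool) → List (Subset n × Fin n)
  pairsOf R = filter (λ p → R (Data.Product.proj₁ p) (Data.Product.proj₂ p) Data.Bool.≟ true)
                     (concatMap (λ D → map (λ a → D , a) (allFin n)) (allSubsets n))

  ⟦_⟧ : Form n m
  ⟦_⟧ = ⋀ (map (λ p → trPair _⇒_ (Data.Product.proj₁ p) (Data.Product.proj₂ p)) (pairsOf enables))
      ∧ ⋀ (map (λ p → trPair _↠_ (Data.Product.proj₁ p) (Data.Product.proj₂ p)) (pairsOf enablesC))

module Submission where

-- (⇒) Fix a configuration C with admissible enumeration es, and write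
--     ⟨C⟩ for ⋀_{x ∈ C} π(x) says x.  Walking along es, every event is
--     derivable once every ⊩-enabled event of C is, since ⊢-steps use
--     the translated ⊢-clauses.  A ⊩-enabled event e is obtained from the
--     clause  π(e) says (⟨C⟩ ↠ e)  by the rule "from A says (φ ↠ ψ) and
--     ψ ⊢ φ infer A says ψ", which lets us temporarily assume the atom e.
--     Assuming the ⊩-events one at a time, by induction on a list of the
--     events not yet assumed, yields  [𝒞] ⊢ ⟨C⟩.
-- (⇐) Soundness w.r.t. a Kripke model whose worlds are sets Y of events
--     "taken for granted": an atom a holds at Y iff a is reachable when
--     the events of Y may fire unconditionally, says is transparent, and
--     φ ↠ ψ holds at Y iff ψ holds at every Z ⊇ Y at which ψ ⇒ φ holds.
--     [𝒞] holds at every world, so a derivable  π(e) says e  holds at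
--     the world ∅, i.e. e is reachable.

open import Defs
open import Data.Nat using (ℕ; zero; suc)
open import Data.Fin using (Fin)
open import Data.Fin.Subset using (Subset; _∈_; _⊆_; _∪_; ⁅_⁆) renaming (⊥ to ∅)
open import Data.Fin.Subset.Properties
  using (_∈?_; ⊆-refl; ⊆-trans; p⊆p∪q; q⊆p∪q; x∈p∪q⁺; x∈p∪q⁻; x∈⁅x⁆; x∈⁅y⁆⇒x≡y; ∉⊥)
open import Data.Vec using () renaming ([] to []ᵛ; _∷_ to _∷ᵛ_)
open import Data.List using (List; []; _∷_; _++_; map; allFin; concatMap)
open import Data.List.Membership.Propositional using () renaming (_∈_ to _∈L_)
open import Data.List.Membership.Propositional.Properties
  using (∈-map⁺; ∈-map⁻; ∈-filter⁺; ∈-filter⁻; ∈-allFin; ∈-++⁺ˡ; ∈-++⁺ʳ; ∈-++⁻; ∈-concatMap⁺)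
open import Data.List.Relation.Unary.Any using (here; there)
import Data.List.Relation.Unary.Any as Any
open import Data.Product using (Σ; _×_; _,_; proj₁; proj₂)
open import Data.Sum using (_⊎_; inj₁; inj₂; [_,_])
open import Data.Unit using (⊤; tt)
open import Data.Empty using (⊥; ⊥-elim)
open import Data.Bool using (Bool; true; false; _≟_)
open import Function.Bundles using (_⇔_; mk⇔; Equivalence)
open import Relation.Binary.PropositionalEquality using (_≡_; refl)

module Hilbert {n m : ℕ} where

  private
    F : Set
    F = Form n m

  weaken : ∀ {Γ Δ : List F} {φ} → (∀ {ψ} → ψ ∈L Γ → ψ ∈L Δ) → Γ ⊢PCL φ → Δ ⊢PCL φ
  weaken s (hyp x)  = hyp (s x)
  weaken s (mp d e) = mp (weaken s d) (weaken s e)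
  weaken s ax-K     = ax-K
  weaken s ax-S     = ax-S
  weaken s ax-∧I    = ax-∧I
  weaken s ax-∧E₁   = ax-∧E₁
  weaken s ax-∧E₂   = ax-∧E₂
  weaken s ax-∨I₁   = ax-∨I₁
  weaken s ax-∨I₂   = ax-∨I₂
  weaken s ax-∨E    = ax-∨E
  weaken s ax-⊥E    = ax-⊥E
  weaken s ax-⊤     = ax-⊤
  weaken s ax-↠⊤    = ax-↠⊤
  weaken s ax-↠fix  = ax-↠fix
  weaken s ax-↠mono = ax-↠mono
  weaken s ax-unit  = ax-unit
  weaken s ax-join  = ax-join
  weaken s ax-map   = ax-map

  weaken₁ : ∀ {Γ : List F} {ψ φ} → Γ ⊢PCL φ → (ψ ∷ Γ) ⊢PCL φ
  weaken₁ = weaken there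

  ⇒-refl : ∀ {Γ : List F} {φ} → Γ ⊢PCL (φ ⇒ φ)
  ⇒-refl {φ = φ} = mp (mp (ax-S {φ = φ} {ψ = φ ⇒ φ} {χ = φ}) ax-K) ax-K

  ⇒-const : ∀ {Γ : List F} {φ ψ} → Γ ⊢PCL ψ → Γ ⊢PCL (φ ⇒ ψ)
  ⇒-const = mp ax-K

  deduction : ∀ {Γ : List F} {φ ψ} → (φ ∷ Γ) ⊢PCL ψ → Γ ⊢PCL (φ ⇒ ψ)
  deduction (hyp (here refl)) = ⇒-refl
  deduction (hyp (there x))   = ⇒-const (hyp x)
  deduction (mp d e)          = mp (mp ax-S (deduction d)) (deduction e)
  deduction ax-K              = ⇒-const ax-K
  deduction ax-S              = ⇒-const ax-S
  deduction ax-∧I             = ⇒-const ax-∧I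
  deduction ax-∧E₁            = ⇒-const ax-∧E₁
  deduction ax-∧E₂            = ⇒-const ax-∧E₂
  deduction ax-∨I₁            = ⇒-const ax-∨I₁
  deduction ax-∨I₂            = ⇒-const ax-∨I₂
  deduction ax-∨E             = ⇒-const ax-∨E
  deduction ax-⊥E             = ⇒-const ax-⊥E
  deduction ax-⊤              = ⇒-const ax-⊤
  deduction ax-↠⊤             = ⇒-const ax-↠⊤
  deduction ax-↠fix           = ⇒-const ax-↠fix
  deduction ax-↠mono          = ⇒-const ax-↠mono
  deduction ax-unit           = ⇒-const ax-unit
  deduction ax-join           = ⇒-const ax-join
  deduction ax-map            = ⇒-const ax-map

  ⋀-intro : ∀ {Γ : List F} (L : List F) → (∀ {φ} → φ ∈L L → Γ ⊢PCL φ) → Γ ⊢PCL ⋀ L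
  ⋀-intro []      f = ax-⊤
  ⋀-intro (φ ∷ L) f = mp (mp ax-∧I (f (here refl))) (⋀-intro L (λ p → f (there p)))

  ⋀-elim : ∀ {Γ : List F} {L : List F} {φ} → φ ∈L L → Γ ⊢PCL ⋀ L → Γ ⊢PCL φ
  ⋀-elim (here refl) d = mp ax-∧E₁ d
  ⋀-elim (there p)   d = ⋀-elim p (mp ax-∧E₂ d)

  says-unit : ∀ {Γ : List F} {A φ} → Γ ⊢PCL φ → Γ ⊢PCL (A says φ)
  says-unit = mp ax-unit

  says-map : ∀ {Γ : List F} {A φ ψ} → Γ ⊢PCL (φ ⇒ ψ) → Γ ⊢PCL (A says φ) → Γ ⊢PCL (A says ψ)
  says-map f = mp (mp ax-map f)

  says-mp : ∀ {Γ : List F} {A φ ψ} → Γ ⊢PCL (A says (φ ⇒ ψ)) → Γ ⊢PCL φ → Γ ⊢PCL (A says ψ)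
  says-mp f x = says-map (deduction (mp (hyp (here refl)) (weaken₁ x))) f

  -- A contractual implication φ ↠ ψ yields any χ lying between them
  -- (χ ⇒ φ and ψ ⇒ χ): weaken it to χ ↠ χ and use the fixpoint axiom.
  ↠-between : ∀ {Γ : List F} {φ ψ χ} →
              Γ ⊢PCL (φ ↠ ψ) → Γ ⊢PCL (χ ⇒ φ) → Γ ⊢PCL (ψ ⇒ χ) → Γ ⊢PCL χ
  ↠-between c χ⇒φ ψ⇒χ = mp ax-↠fix (mp (mp (mp ax-↠mono χ⇒φ) c) ψ⇒χ)

  -- Take χ = φ ∧ A says ψ in ↠-between, then project and flatten says.
  says-↠-elim : ∀ {Γ : List F} {A φ ψ} →
                Γ ⊢PCL (A says (φ ↠ ψ)) → (ψ ∷ Γ) ⊢PCL φ → Γ ⊢PCL (A says ψ)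
  says-↠-elim {Γ} {A} {φ} {ψ} c ψ⊢φ =
    mp ax-join (says-map ax-∧E₂ (says-map (deduction between) c))
    where
    ψ⇒φ∧says : ((φ ↠ ψ) ∷ Γ) ⊢PCL (ψ ⇒ φ ∧ A says ψ)
    ψ⇒φ∧says = deduction (mp (mp ax-∧I (mp (weaken₁ (weaken₁ (deduction ψ⊢φ))) (hyp (here refl))))
                                (says-unit (hyp (here refl))))
    between : ((φ ↠ ψ) ∷ Γ) ⊢PCL (φ ∧ A says ψ)
    between = ↠-between (hyp (here refl)) ax-∧E₁ ψ⇒φ∧says

open Hilbert

allSubsets-complete : ∀ {n} (D : Subset n) → D ∈L allSubsets n
allSubsets-complete {zero}  []ᵛ      = here refl
allSubsets-complete {suc n} (b ∷ᵛ D) =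
  ∈-concatMap⁺ _ (Any.map (λ { refl → extensions b }) (allSubsets-complete D))
  where
  extensions : ∀ b → (b ∷ᵛ D) ∈L ((true ∷ᵛ D) ∷ (false ∷ᵛ D) ∷ [])
  extensions true  = here refl
  extensions false = there (here refl)

elems⁺ : ∀ {n} {D : Subset n} {x} → x ∈ D → x ∈L elems D
elems⁺ {n} {D} {x} x∈D = ∈-filter⁺ (_∈? D) (∈-allFin x) x∈D

elems⁻ : ∀ {n} {D : Subset n} {x} → x ∈L elems D → x ∈ D
elems⁻ {n} {D} p = proj₂ (∈-filter⁻ (_∈? D) {xs = allFin n} p)

module Translation {n m : ℕ} (𝒞 : Contract n m) where
  open Contract 𝒞

  said : Fin n → Form n m
  said x = π x says atom x

  ⟨_⟩ : Subset n → Form n m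
  ⟨ D ⟩ = ⋀ (map said (elems D))

  ⟨⟩-intro : ∀ {Γ} (D : Subset n) → (∀ {x} → x ∈ D → Γ ⊢PCL said x) → Γ ⊢PCL ⟨ D ⟩
  ⟨⟩-intro D f = ⋀-intro (map said (elems D)) λ p → from-elems (∈-map⁻ said p)
    where
    from-elems : ∀ {φ} → Σ (Fin n) (λ x → x ∈L elems D × φ ≡ said x) → _ ⊢PCL φ
    from-elems (x , x∈ , refl) = f (elems⁻ x∈)

  ⟨⟩-elim : ∀ {Γ} {D : Subset n} {x} → x ∈ D → Γ ⊢PCL ⟨ D ⟩ → Γ ⊢PCL said x
  ⟨⟩-elim x∈D = ⋀-elim (∈-map⁺ said (elems⁺ x∈D))

  pairsOf⁺ : (R : Subset n → Fin n → Bool) → ∀ D a → R D a ≡ true → (D , a) ∈L pairsOf 𝒞 R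
  pairsOf⁺ R D a Rda = ∈-filter⁺ (λ p → R (proj₁ p) (proj₂ p) ≟ true) allPairs Rda
    where
    allPairs : (D , a) ∈L concatMap (λ D → map (D ,_) (allFin n)) (allSubsets n)
    allPairs = ∈-concatMap⁺ _ (Any.map (λ { refl → ∈-map⁺ (D ,_) (∈-allFin a) }) (allSubsets-complete D))

  pairsOf⁻ : (R : Subset n → Fin n → Bool) → ∀ {p} → p ∈L pairsOf 𝒞 R → R (proj₁ p) (proj₂ p) ≡ true
  pairsOf⁻ R p = proj₂ (∈-filter⁻ (λ p → R (proj₁ p) (proj₂ p) ≟ true)
                         {xs = concatMap (λ D → map (D ,_) (allFin n)) (allSubsets n)} p)

  ⊢-clause : ∀ {Γ} → Γ ⊢PCL ⟦ 𝒞 ⟧ → ∀ {D a} → enables D a ≡ true →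
             Γ ⊢PCL (π a says (⟨ D ⟩ ⇒ atom a))
  ⊢-clause c {D} {a} en = ⋀-elim (∈-map⁺ _ (pairsOf⁺ enables D a en)) (mp ax-∧E₁ c)

  ⊩-clause : ∀ {Γ} → Γ ⊢PCL ⟦ 𝒞 ⟧ → ∀ {D a} → enablesC D a ≡ true →
             Γ ⊢PCL (π a says (⟨ D ⟩ ↠ atom a))
  ⊩-clause c {D} {a} en = ⋀-elim (∈-map⁺ _ (pairsOf⁺ enablesC D a en)) (mp ax-∧E₂ c)

open Translation

module Completeness {n m : ℕ} (𝒞 : Contract n m) where
  open Contract 𝒞

  along-admissible : ∀ {Γ} → Γ ⊢PCL ⟦ 𝒞 ⟧ → ∀ C →
                     (∀ {e} → enablesC C e ≡ true → Γ ⊢PCL said 𝒞 e) →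
                     ∀ P es → validSeq 𝒞 C P es →
                     (∀ {x} → x ∈ P → Γ ⊢PCL said 𝒞 x) →
                     ∀ {x} → x ∈L es → Γ ⊢PCL said 𝒞 x
  along-admissible {Γ} c C ⊩-derivable P (e ∷ es) (justified , rest) P-derivable = derivable
    where
    e-derivable : Γ ⊢PCL said 𝒞 e
    e-derivable = [ (λ en → says-mp (⊢-clause 𝒞 c en) (⟨⟩-intro 𝒞 P P-derivable)) , ⊩-derivable ] justified

    P∪e-derivable : ∀ {x} → x ∈ P ∪ ⁅ e ⁆ → Γ ⊢PCL said 𝒞 x
    P∪e-derivable x∈ with x∈p∪q⁻ P ⁅ e ⁆ x∈
    ... | inj₁ x∈P = P-derivable x∈P
    ... | inj₂ x∈e with x∈⁅y⁆⇒x≡y e x∈e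
    ... | refl = e-derivable

    derivable : ∀ {x} → x ∈L (e ∷ es) → Γ ⊢PCL said 𝒞 x
    derivable (here refl) = e-derivable
    derivable (there x∈es) = along-admissible c C ⊩-derivable (P ∪ ⁅ e ⁆) es rest P∪e-derivable x∈es

  configuration-derivable : ∀ {Γ} → Γ ⊢PCL ⟦ 𝒞 ⟧ → ∀ {C} → IsConfiguration 𝒞 C →
                            (∀ {e} → enablesC C e ≡ true → Γ ⊢PCL said 𝒞 e) →
                            Γ ⊢PCL ⟨ 𝒞 ⟩ C
  configuration-derivable c {C} (es , enum , valid) ⊩-derivable =
    ⟨⟩-intro 𝒞 C λ {x} x∈C →
      along-admissible c C ⊩-derivable ∅ es valid (λ x∈∅ → ⊥-elim (∉⊥ x∈∅)) (Equivalence.to (enum x) x∈C)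

  -- The ⊩-enabled events of a configuration are derivable; the events in
  -- the list `pending` are those not yet assumed as atoms.  Each pending
  -- event e is discharged by says-↠-elim from the clause π(e) says (⟨C⟩ ↠ e),
  -- using the derivation of ⟨C⟩ that assumes e as an atom.
  ⊩-events-derivable :
    ∀ {C} → IsConfiguration 𝒞 C → (pending : List (Fin n)) → ∀ {Γ} → Γ ⊢PCL ⟦ 𝒞 ⟧ →
    (∀ {e} → enablesC C e ≡ true → e ∈L pending ⊎ Γ ⊢PCL said 𝒞 e) →
    ∀ {e} → enablesC C e ≡ true → Γ ⊢PCL said 𝒞 e
  ⊩-events-derivable conf [] c invariant ce with invariant ce
  ... | inj₁ ()
  ... | inj₂ d = d
  ⊩-events-derivable {C} conf (x ∷ pending) {Γ} c invariant =
    ⊩-events-derivable conf pending c invariant-without-x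
    where
    assuming-x : ∀ {e} → enablesC C e ≡ true → e ∈L pending ⊎ (atom x ∷ Γ) ⊢PCL said 𝒞 e
    assuming-x ce with invariant ce
    ... | inj₁ (here refl) = inj₂ (says-unit (hyp (here refl)))
    ... | inj₁ (there p)   = inj₁ p
    ... | inj₂ d           = inj₂ (weaken₁ d)

    ⟨C⟩-assuming-x : (atom x ∷ Γ) ⊢PCL ⟨ 𝒞 ⟩ C
    ⟨C⟩-assuming-x = configuration-derivable (weaken₁ c) conf
                       (⊩-events-derivable conf pending (weaken₁ c) assuming-x)

    invariant-without-x : ∀ {e} → enablesC C e ≡ true → e ∈L pending ⊎ Γ ⊢PCL said 𝒞 e
    invariant-without-x ce with invariant ce
    ... | inj₁ (here refl) = inj₂ (says-↠-elim (⊩-clause 𝒞 c ce) ⟨C⟩-assuming-x)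
    ... | inj₁ (there p)   = inj₁ p
    ... | inj₂ d           = inj₂ d

  reachable⇒derivable : ∀ e → Reachable 𝒞 e → (⟦ 𝒞 ⟧ ∷ []) ⊢PCL said 𝒞 e
  reachable⇒derivable e (C , conf , e∈C) =
    ⟨⟩-elim 𝒞 e∈C (configuration-derivable c conf
      (⊩-events-derivable conf (allFin n) c (λ {e} _ → inj₁ (∈-allFin e))))
    where
    c : (⟦ 𝒞 ⟧ ∷ []) ⊢PCL ⟦ 𝒞 ⟧
    c = hyp (here refl)

module Soundness {n m : ℕ} (𝒞 : Contract n m) where
  open Contract 𝒞

  ∅⊆ : ∀ {P : Subset n} → ∅ ⊆ P
  ∅⊆ x∈∅ = ⊥-elim (∉⊥ x∈∅)

  ∪-monoˡ : ∀ {P P′ : Subset n} (Q : Subset n) → P ⊆ P′ → P ∪ Q ⊆ P′ ∪ Q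
  ∪-monoˡ {P} Q P⊆P′ x∈ = [ (λ x∈P → x∈p∪q⁺ (inj₁ (P⊆P′ x∈P))) , (λ x∈Q → x∈p∪q⁺ (inj₂ x∈Q)) ]
                            (x∈p∪q⁻ P Q x∈)

  -- Event e may follow the events P in an enumeration of C when the events
  -- of Y are granted (may fire unconditionally).  For Y = ∅ this is the
  -- condition of validSeq.
  Justified : (Y C P : Subset n) → Fin n → Set
  Justified Y C P e = enables P e ≡ true ⊎ enablesC C e ≡ true ⊎ e ∈ Y

  Admissible : (Y C P : Subset n) → List (Fin n) → Set
  Admissible Y C P []       = ⊤
  Admissible Y C P (e ∷ es) = Justified Y C P e × Admissible Y C (P ∪ ⁅ e ⁆) es

  admissible⇒valid : ∀ {C P} es → Admissible ∅ C P es → validSeq 𝒞 C P es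
  admissible⇒valid []       tt                           = tt
  admissible⇒valid (e ∷ es) (inj₁ en , rest)             = inj₁ en , admissible⇒valid es rest
  admissible⇒valid (e ∷ es) (inj₂ (inj₁ ec) , rest)      = inj₂ ec , admissible⇒valid es rest
  admissible⇒valid (e ∷ es) (inj₂ (inj₂ e∈∅) , rest)     = ⊥-elim (∉⊥ e∈∅)

  _∪ˡ_ : Subset n → List (Fin n) → Subset n
  P ∪ˡ []       = P
  P ∪ˡ (e ∷ es) = (P ∪ ⁅ e ⁆) ∪ˡ es

  ∪ˡ-⊇ : ∀ P es → P ⊆ P ∪ˡ es
  ∪ˡ-⊇ P []       = ⊆-refl
  ∪ˡ-⊇ P (e ∷ es) = ⊆-trans (p⊆p∪q ⁅ e ⁆) (∪ˡ-⊇ (P ∪ ⁅ e ⁆) es)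

  ∪ˡ-∈ : ∀ P es {x} → x ∈L es → x ∈ P ∪ˡ es
  ∪ˡ-∈ P (e ∷ es) (here refl)  = ∪ˡ-⊇ (P ∪ ⁅ e ⁆) es (x∈p∪q⁺ (inj₂ (x∈⁅x⁆ e)))
  ∪ˡ-∈ P (e ∷ es) (there x∈es) = ∪ˡ-∈ (P ∪ ⁅ e ⁆) es x∈es

  _≼[_]_ : Subset n → Subset n → Subset n → Set
  Y ≼[ C′ ] Y′ = ∀ {e} → e ∈ Y → e ∈ Y′ ⊎ enablesC C′ e ≡ true

  ⊆⇒≼ : ∀ {Y Y′ C′} → Y ⊆ Y′ → Y ≼[ C′ ] Y′
  ⊆⇒≼ Y⊆Y′ e∈Y = inj₁ (Y⊆Y′ e∈Y)

  justified-mono : ∀ {Y Y′ C C′ P P′ e} → Y ≼[ C′ ] Y′ → C ⊆ C′ → P ⊆ P′ →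
                   Justified Y C P e → Justified Y′ C′ P′ e
  justified-mono _   _    P⊆P′ (inj₁ en)         = inj₁ (sat-⊢ _ _ _ P⊆P′ en)
  justified-mono _   C⊆C′ _    (inj₂ (inj₁ ec))  = inj₂ (inj₁ (sat-⊩ _ _ _ C⊆C′ ec))
  justified-mono cov _    _    (inj₂ (inj₂ e∈Y)) = [ (λ e∈Y′ → inj₂ (inj₂ e∈Y′)) , (λ ec → inj₂ (inj₁ ec)) ]
                                                     (cov e∈Y)

  admissible-mono : ∀ {Y Y′ C C′ P P′} es → Y ≼[ C′ ] Y′ → C ⊆ C′ → P ⊆ P′ →
                    Admissible Y C P es → Admissible Y′ C′ P′ es
  admissible-mono []       _   _    _    tt              = tt
  admissible-mono (e ∷ es) cov C⊆C′ P⊆P′ (justified , rest) =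
    justified-mono cov C⊆C′ P⊆P′ justified , admissible-mono es cov C⊆C′ (∪-monoˡ ⁅ e ⁆ P⊆P′) rest

  admissible-++ : ∀ {Y C P} l₁ l₂ → Admissible Y C P l₁ → Admissible Y C (P ∪ˡ l₁) l₂ →
                  Admissible Y C P (l₁ ++ l₂)
  admissible-++ []       l₂ tt                 a₂ = a₂
  admissible-++ (e ∷ l₁) l₂ (justified , rest) a₂ = justified , admissible-++ l₁ l₂ rest a₂

  Enumerates : List (Fin n) → Subset n → Set
  Enumerates es C = ∀ x → (x ∈ C) ⇔ (x ∈L es)

  enumerates-∅ : Enumerates [] ∅
  enumerates-∅ x = mk⇔ (λ x∈∅ → ⊥-elim (∉⊥ x∈∅)) (λ ())

  enumerates-⁅⁆ : ∀ a → Enumerates (a ∷ []) ⁅ a ⁆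
  enumerates-⁅⁆ a x = mk⇔ (λ x∈a → here (x∈⁅y⁆⇒x≡y a x∈a)) (λ { (here refl) → x∈⁅x⁆ a })

  enumerates-++ : ∀ {l₁ l₂ C₁ C₂} → Enumerates l₁ C₁ → Enumerates l₂ C₂ →
                  Enumerates (l₁ ++ l₂) (C₁ ∪ C₂)
  enumerates-++ {l₁} {l₂} {C₁} {C₂} enum₁ enum₂ x = mk⇔ to from
    where
    to : x ∈ C₁ ∪ C₂ → x ∈L (l₁ ++ l₂)
    to x∈ = [ (λ x∈C₁ → ∈-++⁺ˡ (Equivalence.to (enum₁ x) x∈C₁))
            , (λ x∈C₂ → ∈-++⁺ʳ l₁ (Equivalence.to (enum₂ x) x∈C₂)) ] (x∈p∪q⁻ C₁ C₂ x∈)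
    from : x ∈L (l₁ ++ l₂) → x ∈ C₁ ∪ C₂
    from x∈ = x∈p∪q⁺ ([ (λ x∈l₁ → inj₁ (Equivalence.from (enum₁ x) x∈l₁))
                      , (λ x∈l₂ → inj₂ (Equivalence.from (enum₂ x) x∈l₂)) ] (∈-++⁻ l₁ x∈))

  ConfigurationUnder : Subset n → Subset n → Set
  ConfigurationUnder Y C = Σ (List (Fin n)) λ es → Enumerates es C × Admissible Y C ∅ es

  ReachableUnder : Subset n → Fin n → Set
  ReachableUnder Y a = Σ (Subset n) λ C → ConfigurationUnder Y C × a ∈ C

  reachable-mono : ∀ {Y Y′} a → Y ⊆ Y′ → ReachableUnder Y a → ReachableUnder Y′ a
  reachable-mono a Y⊆Y′ (C , (es , enum , adm) , a∈C) =
    C , (es , enum , admissible-mono es (⊆⇒≼ Y⊆Y′) ⊆-refl ⊆-refl adm) , a∈C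

  granted-reachable : ∀ {Y} a → a ∈ Y → ReachableUnder Y a
  granted-reachable a a∈Y = ⁅ a ⁆ , (a ∷ [] , enumerates-⁅⁆ a , inj₂ (inj₂ a∈Y) , tt) , x∈⁅x⁆ a

  configuration-∪ : ∀ {Y C₁ C₂} → ConfigurationUnder Y C₁ → ConfigurationUnder Y C₂ →
                    ConfigurationUnder Y (C₁ ∪ C₂)
  configuration-∪ {Y} {C₁} {C₂} (l₁ , enum₁ , adm₁) (l₂ , enum₂ , adm₂) =
    l₁ ++ l₂ , enumerates-++ enum₁ enum₂ ,
    admissible-++ l₁ l₂ (admissible-mono l₁ (⊆⇒≼ ⊆-refl) (p⊆p∪q C₂) ⊆-refl adm₁)
                        (admissible-mono l₂ (⊆⇒≼ ⊆-refl) (q⊆p∪q C₁ C₂) ∅⊆ adm₂)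

  covering-configuration : ∀ {Y} (L : List (Fin n)) → (∀ {d} → d ∈L L → ReachableUnder Y d) →
                           Σ (Subset n) λ C → ConfigurationUnder Y C × (∀ {d} → d ∈L L → d ∈ C)
  covering-configuration []      _         = ∅ , ([] , enumerates-∅ , tt) , λ ()
  covering-configuration (x ∷ L) reachable
    with reachable (here refl) | covering-configuration L (λ d∈L → reachable (there d∈L))
  ... | C₁ , conf₁ , x∈C₁ | C₂ , conf₂ , L⊆C₂ = C₁ ∪ C₂ , configuration-∪ conf₁ conf₂ , covers
    where
    covers : ∀ {d} → d ∈L (x ∷ L) → d ∈ C₁ ∪ C₂
    covers (here refl) = x∈p∪q⁺ (inj₁ x∈C₁)
    covers (there d∈L) = x∈p∪q⁺ (inj₂ (L⊆C₂ d∈L))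

  extend-⊢ : ∀ {Y C D a} → ConfigurationUnder Y C → D ⊆ C → enables D a ≡ true →
             ConfigurationUnder Y (C ∪ ⁅ a ⁆)
  extend-⊢ {Y} {C} {D} {a} (l , enum , adm) D⊆C en =
    l ++ a ∷ [] , enumerates-++ enum (enumerates-⁅⁆ a) ,
    admissible-++ l (a ∷ []) (admissible-mono l (⊆⇒≼ ⊆-refl) (p⊆p∪q ⁅ a ⁆) ⊆-refl adm)
                  (inj₁ (sat-⊢ D (∅ ∪ˡ l) a D⊆∅∪l en) , tt)
    where
    D⊆∅∪l : D ⊆ ∅ ∪ˡ l
    D⊆∅∪l d∈D = ∪ˡ-∈ ∅ l (Equivalence.to (enum _) (D⊆C d∈D))

  extend-⊩ : ∀ {Y C a} → ConfigurationUnder (Y ∪ ⁅ a ⁆) C → enablesC (⁅ a ⁆ ∪ C) a ≡ true →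
             ConfigurationUnder Y (⁅ a ⁆ ∪ C)
  extend-⊩ {Y} {C} {a} (l , enum , adm) ec =
    a ∷ l , enumerates-++ (enumerates-⁅⁆ a) enum ,
    inj₂ (inj₁ ec) , admissible-mono l a-covered (q⊆p∪q ⁅ a ⁆ C) ∅⊆ adm
    where
    a-covered : (Y ∪ ⁅ a ⁆) ≼[ ⁅ a ⁆ ∪ C ] Y
    a-covered e∈ with x∈p∪q⁻ Y ⁅ a ⁆ e∈
    ... | inj₁ e∈Y = inj₁ e∈Y
    ... | inj₂ e∈a with x∈⁅y⁆⇒x≡y a e∈a
    ... | refl = inj₂ ec

  -- The Kripke model: worlds are sets of granted events, ordered by ⊆.
  Forces : Form n m → Subset n → Set
  Forces (atom a)   Y = ReachableUnder Y a
  Forces ⊤′         Y = ⊤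
  Forces ⊥′         Y = ⊥
  Forces (φ ∧ ψ)    Y = Forces φ Y × Forces ψ Y
  Forces (φ ∨ ψ)    Y = Forces φ Y ⊎ Forces ψ Y
  Forces (φ ⇒ ψ)    Y = ∀ Z → Y ⊆ Z → Forces φ Z → Forces ψ Z
  Forces (φ ↠ ψ)    Y = ∀ Z → Y ⊆ Z → (∀ W → Z ⊆ W → Forces ψ W → Forces φ W) → Forces ψ Z
  Forces (A says φ) Y = Forces φ Y

  forces-mono : ∀ φ {Y Z} → Y ⊆ Z → Forces φ Y → Forces φ Z
  forces-mono (atom a)   Y⊆Z f       = reachable-mono a Y⊆Z f
  forces-mono ⊤′         Y⊆Z f       = tt
  forces-mono (φ ∧ ψ)    Y⊆Z (f , g) = forces-mono φ Y⊆Z f , forces-mono ψ Y⊆Z g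
  forces-mono (φ ∨ ψ)    Y⊆Z (inj₁ f) = inj₁ (forces-mono φ Y⊆Z f)
  forces-mono (φ ∨ ψ)    Y⊆Z (inj₂ g) = inj₂ (forces-mono ψ Y⊆Z g)
  forces-mono (φ ⇒ ψ)    Y⊆Z f       = λ W Z⊆W → f W (⊆-trans Y⊆Z Z⊆W)
  forces-mono (φ ↠ ψ)    Y⊆Z f       = λ W Z⊆W → f W (⊆-trans Y⊆Z Z⊆W)
  forces-mono (A says φ) Y⊆Z f       = forces-mono φ Y⊆Z f

  sound : ∀ {Γ φ} → Γ ⊢PCL φ → ∀ Y → (∀ {ψ} → ψ ∈L Γ → Forces ψ Y) → Forces φ Y
  sound (hyp ψ∈Γ)  Y Γ-forced = Γ-forced ψ∈Γ
  sound (mp d e)   Y Γ-forced = sound d Y Γ-forced Y ⊆-refl (sound e Y Γ-forced)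
  sound (ax-K {φ}) Y _ = λ Z _ f W Z⊆W _ → forces-mono φ Z⊆W f
  sound ax-S       Y _ = λ Z₁ _ f Z₂ s₂ g Z₃ s₃ x → f Z₃ (⊆-trans s₂ s₃) x Z₃ ⊆-refl (g Z₃ s₃ x)
  sound (ax-∧I {φ}) Y _ = λ Z _ f W Z⊆W g → forces-mono φ Z⊆W f , g
  sound ax-∧E₁     Y _ = λ Z _ → proj₁
  sound ax-∧E₂     Y _ = λ Z _ → proj₂
  sound ax-∨I₁     Y _ = λ Z _ → inj₁
  sound ax-∨I₂     Y _ = λ Z _ → inj₂
  sound ax-∨E      Y _ = λ Z₁ _ f Z₂ s₂ g Z₃ s₃ → [ f Z₃ (⊆-trans s₂ s₃) , g Z₃ s₃ ]
  sound ax-⊥E      Y _ = λ Z _ ()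
  sound ax-⊤       Y _ = tt
  sound ax-↠⊤      Y _ = λ Z _ _ → tt
  sound ax-↠fix    Y _ = λ Z _ c → c Z ⊆-refl (λ W _ f → f)
  sound ax-↠mono   Y _ = λ Z₁ _ φ′⇒φ Z₂ s₂ c Z₃ s₃ ψ⇒ψ′ Z₄ s₄ ψ′⇒φ′ →
    ψ⇒ψ′ Z₄ s₄ (c Z₄ (⊆-trans s₃ s₄) λ W s g →
      φ′⇒φ W (⊆-trans s₂ (⊆-trans s₃ (⊆-trans s₄ s))) (ψ′⇒φ′ W s (ψ⇒ψ′ W (⊆-trans s₄ s) g)))
  sound ax-unit    Y _ = λ Z _ f → f
  sound ax-join    Y _ = λ Z _ f → f
  sound ax-map     Y _ = λ Z _ f → f

  forces-⋀ : ∀ {Y} (L : List (Form n m)) → (∀ {φ} → φ ∈L L → Forces φ Y) → Forces (⋀ L) Y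
  forces-⋀ []      f = tt
  forces-⋀ (φ ∷ L) f = f (here refl) , forces-⋀ L (λ p → f (there p))

  forces-⋀⁻ : ∀ {Y} {L : List (Form n m)} {φ} → φ ∈L L → Forces (⋀ L) Y → Forces φ Y
  forces-⋀⁻ (here refl) (f , _) = f
  forces-⋀⁻ (there p)   (_ , g) = forces-⋀⁻ p g

  premise-configuration : ∀ {Y} (D : Subset n) → Forces (⟨ 𝒞 ⟩ D) Y →
                          Σ (Subset n) λ C → ConfigurationUnder Y C × D ⊆ C
  premise-configuration D f with covering-configuration (elems D) (λ d∈ → forces-⋀⁻ (∈-map⁺ (said 𝒞) d∈) f)
  ... | C , conf , elems⊆C = C , conf , λ d∈D → elems⊆C (elems⁺ d∈D)

  forces-⊢-clause : ∀ {D a} → enables D a ≡ true → ∀ Y → Forces (trPair 𝒞 _⇒_ D a) Y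
  forces-⊢-clause {D} {a} en Y Z _ premise with premise-configuration D premise
  ... | C , conf , D⊆C = C ∪ ⁅ a ⁆ , extend-⊢ conf D⊆C en , x∈p∪q⁺ (inj₂ (x∈⁅x⁆ a))

  forces-⊩-clause : ∀ {D a} → enablesC D a ≡ true → ∀ Y → Forces (trPair 𝒞 _↠_ D a) Y
  forces-⊩-clause {D} {a} ec Y Z _ guarantee
    with premise-configuration D (guarantee (Z ∪ ⁅ a ⁆) (p⊆p∪q ⁅ a ⁆) (granted-reachable a (q⊆p∪q Z ⁅ a ⁆ (x∈⁅x⁆ a))))
  ... | C , conf , D⊆C =
    ⁅ a ⁆ ∪ C , extend-⊩ conf (sat-⊩ D (⁅ a ⁆ ∪ C) a (λ d∈D → q⊆p∪q ⁅ a ⁆ C (D⊆C d∈D)) ec) ,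
    x∈p∪q⁺ (inj₁ (x∈⁅x⁆ a))

  forces-contract : ∀ Y → Forces ⟦ 𝒞 ⟧ Y
  forces-contract Y = forces-⋀ _ (λ p → ⊢-clauses (∈-map⁻ _ p)) , forces-⋀ _ (λ p → ⊩-clauses (∈-map⁻ _ p))
    where
    ⊢-clauses : ∀ {φ} → Σ _ (λ q → q ∈L pairsOf 𝒞 enables × φ ≡ trPair 𝒞 _⇒_ (proj₁ q) (proj₂ q)) → Forces φ Y
    ⊢-clauses (_ , q∈ , refl) = forces-⊢-clause (pairsOf⁻ 𝒞 enables q∈) Y
    ⊩-clauses : ∀ {φ} → Σ _ (λ q → q ∈L pairsOf 𝒞 enablesC × φ ≡ trPair 𝒞 _↠_ (proj₁ q) (proj₂ q)) → Forces φ Y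
    ⊩-clauses (_ , q∈ , refl) = forces-⊩-clause (pairsOf⁻ 𝒞 enablesC q∈) Y

  derivable⇒reachable : ∀ e → (⟦ 𝒞 ⟧ ∷ []) ⊢PCL said 𝒞 e → Reachable 𝒞 e
  derivable⇒reachable e d with sound d ∅ (λ { (here refl) → forces-contract ∅ })
  ... | C , (es , enum , adm) , e∈C = C , (es , enum , admissible⇒valid es adm) , e∈C

theorem2 : {n m : ℕ} (𝒞 : Contract n m) (e : Fin n) →
    Reachable 𝒞 e ⇔ ((⟦ 𝒞 ⟧ ∷ []) ⊢PCL (Contract.π 𝒞 e says atom e))
theorem2 𝒞 e = mk⇔ (Completeness.reachable⇒derivable 𝒞 e) (Soundness.derivable⇒reachable 𝒞 e)
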